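{- For every integer $r > 1$, $\mu(r) = m(r)$.
   Context: For a positive integer $n$, the unitary Cayley graph $X_n = \mathrm{Cay}(\mathbb{Z}_n, U_n)$ has vertex set $\mathbb{Z}_n$, and $x,y$ are adjacent iff $x - y \in U_n$, the group of units of $\mathbb{Z}_n$. An induced cycle of length $k \geq 3$ in a graph is a sequence of $k$ distinct vertices $v_0, \dots, v_{k-1}$ such that $v_i$ and $v_j$ are adjacent if and only if $i - j \equiv \pm 1 \pmod k$. $M(n)$ is the length of the longest induced cycle in $X_n$, and $m(r) = \max_n M(n)$ over all $n$ with exactly $r$ distinct prime divisors. A complete $k$-partite graph is a graph whose vertex set is partitioned into $k$ nonempty parts, two vertices being adjacent iff they lie in different parts. The conjunction $G_1 \wedge G_2$ of graphs has vertex set $V(G_1) \times V(G_2)$, with $(v_1,v_2)$ adjacent to $(u_1,u_2)$ iff $v_1u_1 \in E(G_1)$ and $v_2u_2 \in E(G_2)$; iterated conjunctions $G_1 \wedge \cdots \wedge G_r$ are defined analogously. For a multiset $S = \{k_1, \dots, k_r\}$ of positive integers, $\mathcal{G}^S$ is the class of graphs $G_1 \wedge \cdots \wedge G_r$ with each $G_i$ complete $k_i$-partite. $\mu(r)$ is the maximum length of an induced cycle in any graph belonging to $\mathcal{G}^S$ for any multiset $S$ of $r$ positive integers. -}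

module Defs where

open import Data.Nat using (ℕ; zero; suc; _+_; _∸_; _≤_; _≥_; _%_; NonZero)
open import Data.Nat.Divisibility using (_∣_)
open import Data.Nat.Coprimality using (Coprime)
open import Data.Nat.Primality using (Prime)
open import Data.Fin using (Fin; toℕ)
open import Data.List using (List; length)
open import Data.List.Relation.Unary.All using (All)
open import Data.List.Relation.Unary.Unique.Propositional using (Unique)
open import Data.List.Membership.Propositional using (_∈_)
open import Data.Product using (Σ; ∃; _×_)
open import Data.Sum using (_⊎_)
open import Data.Empty using (⊥)
open import Relation.Binary.PropositionalEquality using (_≡_; _≢_)

CycAdj : (k : ℕ) → Fin k → Fin k → Set
CycAdj zero a b = ⊥
CycAdj (suc k) a b =
  (toℕ b ≡ suc (toℕ a) % suc k) ⊎ (toℕ a ≡ suc (toℕ b) % suc k)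

IsInducedCycle : {V : Set} → (V → V → Set) → (V → V → Set) →
                 (k : ℕ) → (Fin k → V) → Set
IsInducedCycle {V} _≈_ Adj k v =
  (k ≥ 3)
  × (∀ a b → v a ≈ v b → a ≡ b)
  × (∀ a b → Adj (v a) (v b) → CycAdj k a b)
  × (∀ a b → CycAdj k a b → Adj (v a) (v b))

IsMax : (ℕ → Set) → ℕ → Set
IsMax P k = P k × (∀ j → P j → j ≤ k)

-- Unitary Cayley graph X_n on Z_n = Fin n : x ~ y iff x - y is a unit,
-- i.e. (x - y mod n) is coprime to n.

UnitaryAdj : (n : ℕ) → .{{NonZero n}} → Fin n → Fin n → Set
UnitaryAdj n x y = Coprime ((toℕ x + (n ∸ toℕ y)) % n) n

HasPrimeDivisorCount : ℕ → ℕ → Set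
HasPrimeDivisorCount n r =
  Σ (List ℕ) λ ps →
    Unique ps × All Prime ps × All (_∣ n) ps
    × (∀ p → Prime p → p ∣ n → p ∈ ps) × length ps ≡ r

XHasInducedCycle : (n : ℕ) → .{{NonZero n}} → ℕ → Set
XHasInducedCycle n k = Σ (Fin k → Fin n) λ v → IsInducedCycle _≡_ (UnitaryAdj n) k v

mSet : ℕ → ℕ → Set
mSet r k = Σ ℕ λ n → HasPrimeDivisorCount (suc n) r × XHasInducedCycle (suc n) k

IsM : ℕ → ℕ → Set
IsM r k = IsMax (mSet r) k

-- A complete k-partite graph on the finite vertex set Fin N is given by a
-- surjective part labelling f : Fin N → Fin k (parts = fibres, all nonempty);
-- x ~ y iff f x ≢ f y.  The conjunction G_1 ∧ ⋯ ∧ G_r has vertices the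
-- tuples (i : Fin r) → Fin (N i), adjacent iff adjacent in every coordinate.

record ConjMultipartite (r : ℕ) : Set where
  field
    parts     : Fin r → ℕ
    parts-pos : ∀ i → 1 ≤ parts i
    size      : Fin r → ℕ
    label     : (i : Fin r) → Fin (size i) → Fin (parts i)
    label-sur : ∀ i (c : Fin (parts i)) → ∃ λ x → label i x ≡ c

  Vertex : Set
  Vertex = (i : Fin r) → Fin (size i)

  _≈V_ : Vertex → Vertex → Set
  x ≈V y = ∀ i → x i ≡ y i

  Adj : Vertex → Vertex → Set
  Adj x y = ∀ i → label i (x i) ≢ label i (y i)

μSet : ℕ → ℕ → Set
μSet r k = Σ (ConjMultipartite r) λ G →
  Σ (Fin k → ConjMultipartite.Vertex G) λ v →
    IsInducedCycle (ConjMultipartite._≈V_ G) (ConjMultipartite.Adj G) k v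

Isμ : ℕ → ℕ → Set
Isμ r k = IsMax (μSet r) k

module Submission where

-- Label x ∈ ℤ_n by its residues modulo the prime divisors p₁, …, p_r of n. Since x − y is a
-- unit iff x ≢ y modulo every p_i, an induced cycle of X_n is an induced cycle of the
-- conjunction of the complete p_i-partite graphs on ℤ_n. Conversely, adjacency in a
-- conjunction of complete k_i-partite graphs only sees the part labels of the vertices:
-- choosing distinct primes p_i ≥ k_i, the Chinese remainder theorem realises the labels of
-- a cycle as residues of integers modulo n = (p₁ ⋯ p_r)^(k+1), and adding distinct multiples
-- of p₁ ⋯ p_r keeps its k vertices distinct. So both families have induced cycles of exactly
-- the same lengths, and their maxima agree.

open import Data.Nat
open import Data.Nat.Properties
open import Data.Nat.Divisibility
open import Data.Nat.DivMod
open import Data.Nat.Coprimality using (Coprime)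
open import Data.Nat.Primality
open import Data.Nat.Primality.Factorisation
  using (factorise; PrimeFactorisation; factorisationHasAllPrimeFactors)
open import Data.Nat.ListAction using (product)
open import Data.Nat.ListAction.Properties using (∈⇒∣product)
open import Algebra.Properties.CommutativeMonoid.Sum +-0-commutativeMonoid using (sum; sum-remove)
import Data.Fin as Fin
open import Data.Fin using (Fin; toℕ; fromℕ<; punchIn; punchOut)
open import Data.Fin.Properties using (toℕ<n; toℕ-fromℕ<; toℕ-injective; punchInᵢ≢i; punchIn-punchOut)
open import Data.Vec.Functional using (removeAt)
open import Data.List using (List; []; _∷_; lookup; tabulate)
open import Data.List.Properties using (length-tabulate)
open import Data.List.Relation.Unary.All using (All; _∷_)
import Data.List.Relation.Unary.All as All
import Data.List.Relation.Unary.All.Properties as All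
open import Data.List.Relation.Unary.Any using (index)
open import Data.List.Relation.Unary.Any.Properties using (lookup-index)
import Data.List.Relation.Unary.Unique.Propositional.Properties as Unique
open import Data.List.Membership.Propositional using (_∈_)
open import Data.List.Membership.Propositional.Properties using (∈-lookup; ∈-tabulate⁺; ∈-tabulate⁻)
open import Data.Product using (∃-syntax; _×_; _,_; proj₁; proj₂)
open import Data.Sum using (inj₁; inj₂)
open import Function.Base using (_∘_)
open import Function.Bundles using (_⇔_; mk⇔; Equivalence)
open import Function.Construct.Composition using (_⇔-∘_)
open import Function.Construct.Symmetry using (⇔-sym)
open import Relation.Nullary using (¬_; yes; no; contradiction)
open import Relation.Binary.Definitions using (tri<; tri≈; tri>)
open import Relation.Binary.PropositionalEquality

open import Defs

prime-factor : ∀ n → 1 < n → ∃[ q ] Prime q × q ∣ n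
prime-factor n@(suc _) 1<n = go factors isFactorisation factorsPrime
  where
  open PrimeFactorisation (factorise n)
  go : (qs : List ℕ) → n ≡ product qs → All Prime qs → ∃[ q ] Prime q × q ∣ n
  go []       n≡1      _             = contradiction n≡1 (>⇒≢ 1<n)
  go (q ∷ qs) n≡q*qs   (q-prime ∷ _) = q , q-prime , subst (q ∣_) (sym n≡q*qs) (m∣m*n (product qs))

prime⇒>1 : ∀ {p} → Prime p → 1 < p
prime⇒>1 {p} p-prime = nonTrivial⇒n>1 p {{prime⇒nonTrivial p-prime}}

m≤n⇒m∣n! : ∀ {m n} → 0 < m → m ≤ n → m ∣ n !
m≤n⇒m∣n! {suc m} _ m≤n = ∣-trans (m∣m*n (m !)) (m≤n⇒m!∣n! m≤n)

∃-prime> : ∀ m → ∃[ p ] Prime p × m < p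
∃-prime> m with prime-factor (m ! + 1) (+-monoˡ-≤ 1 (1≤n! m))
... | q , q-prime , q∣m!+1 with m <? q
...   | yes m<q = q , q-prime , m<q
...   | no  m≮q = contradiction (∣1⇒≡1 q∣1) (>⇒≢ (prime⇒>1 q-prime))
  where
  q∣1 : q ∣ 1
  q∣1 = ∣m+n∣m⇒∣n q∣m!+1 (m≤n⇒m∣n! (<-trans z<s (prime⇒>1 q-prime)) (≮⇒≥ m≮q))

step-increasing⇒strictMono : (f : ℕ → ℕ) → (∀ i → f i < f (suc i)) → ∀ {i j} → i < j → f i < f j
step-increasing⇒strictMono f step {i} {suc j} i<1+j with m<1+n⇒m<n∨m≡n i<1+j
... | inj₁ i<j  = <-trans (step-increasing⇒strictMono f step i<j) (step j)
... | inj₂ refl = step i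

step-increasing⇒injective : (f : ℕ → ℕ) → (∀ i → f i < f (suc i)) → ∀ {i j} → f i ≡ f j → i ≡ j
step-increasing⇒injective f step {i} {j} fᵢ≡fⱼ with <-cmp i j
... | tri< i<j _ _ = contradiction fᵢ≡fⱼ (<⇒≢ (step-increasing⇒strictMono f step i<j))
... | tri≈ _ i≡j _ = i≡j
... | tri> _ _ j<i = contradiction (sym fᵢ≡fⱼ) (<⇒≢ (step-increasing⇒strictMono f step j<i))

nextPrime : ℕ → ℕ
nextPrime m = proj₁ (∃-prime> m)

nextPrime-prime : ∀ m → Prime (nextPrime m)
nextPrime-prime m = proj₁ (proj₂ (∃-prime> m))

<nextPrime : ∀ m → m < nextPrime m
<nextPrime m = proj₂ (proj₂ (∃-prime> m))

primeAbove : ℕ → ℕ → ℕ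
primeAbove K zero    = nextPrime K
primeAbove K (suc i) = nextPrime (primeAbove K i)

primeAbove-prime : ∀ K i → Prime (primeAbove K i)
primeAbove-prime K zero    = nextPrime-prime K
primeAbove-prime K (suc i) = nextPrime-prime (primeAbove K i)

<primeAbove : ∀ K i → K < primeAbove K i
<primeAbove K zero    = <nextPrime K
<primeAbove K (suc i) = <-trans (<primeAbove K i) (<nextPrime (primeAbove K i))

primeAbove-injective : ∀ K {i j} → primeAbove K i ≡ primeAbove K j → i ≡ j
primeAbove-injective K = step-increasing⇒injective (primeAbove K) (<nextPrime ∘ primeAbove K)

prime∣m^n⇒∣m : ∀ {p} m n → Prime p → p ∣ m ^ n → p ∣ m
prime∣m^n⇒∣m m zero    p-prime p∣1 = contradiction (∣1⇒≡1 p∣1) (>⇒≢ (prime⇒>1 p-prime))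
prime∣m^n⇒∣m m (suc n) p-prime p∣m*mⁿ with euclidsLemma m (m ^ n) p-prime p∣m*mⁿ
... | inj₁ p∣m  = p∣m
... | inj₂ p∣mⁿ = prime∣m^n⇒∣m m n p-prime p∣mⁿ

n<m^n : ∀ {m} → 1 < m → ∀ n → n < m ^ n
n<m^n 1<m zero    = z<s
n<m^n 1<m (suc n) = ≤-<-trans (n<m^n 1<m n) (^-monoʳ-< _ 1<m (n<1+n n))

coprime⇔noCommonPrimeDivisor : ∀ m n → Coprime m n ⇔ (∀ {q} → Prime q → q ∣ m → ¬ q ∣ n)
coprime⇔noCommonPrimeDivisor m n = mk⇔ coprime⇒noPrime noPrime⇒coprime
  where
  coprime⇒noPrime : Coprime m n → ∀ {q} → Prime q → q ∣ m → ¬ q ∣ n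
  coprime⇒noPrime coprime q-prime q∣m q∣n = >⇒≢ (prime⇒>1 q-prime) (coprime (q∣m , q∣n))
  noPrime⇒coprime : (∀ {q} → Prime q → q ∣ m → ¬ q ∣ n) → Coprime m n
  noPrime⇒coprime h {0}          (0∣m , 0∣n) with 0∣⇒≡0 0∣m | 0∣⇒≡0 0∣n
  ... | refl | refl = contradiction (2 ∣0) (h prime[2] (2 ∣0))
  noPrime⇒coprime h {1}          _           = refl
  noPrime⇒coprime h {d@(2+ _)}   (d∣m , d∣n) with prime-factor d (s<s z<s)
  ... | q , q-prime , q∣d = contradiction (∣-trans q∣d d∣n) (h q-prime (∣-trans q∣d d∣m))

∣∧<⇒≡0 : ∀ {d m} → d ∣ m → m < d → m ≡ 0
∣∧<⇒≡0 {m = zero}  _   _   = refl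
∣∧<⇒≡0 {m = suc _} d∣m m<d = contradiction d∣m (>⇒∤ m<d)

%≡%⇒∣∸ : ∀ m n d .{{_ : NonZero d}} → m % d ≡ n % d → d ∣ m ∸ n
%≡%⇒∣∸ m n d m%d≡n%d = divides (m / d ∸ n / d) (begin
  m ∸ n                                     ≡⟨ cong₂ _∸_ (m≡m%n+[m/n]*n m d) (m≡m%n+[m/n]*n n d) ⟩
  (m % d + m / d * d) ∸ (n % d + n / d * d) ≡⟨ cong (λ r → (r + m / d * d) ∸ (n % d + n / d * d)) m%d≡n%d ⟩
  (n % d + m / d * d) ∸ (n % d + n / d * d) ≡⟨ [m+n]∸[m+o]≡n∸o (n % d) (m / d * d) (n / d * d) ⟩
  m / d * d ∸ n / d * d                     ≡⟨ *-distribʳ-∸ d (m / d) (n / d) ⟨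
  (m / d ∸ n / d) * d                       ∎)
  where open ≡-Reasoning

*-cancelʳ-%-prime : ∀ {p} .{{_ : NonZero p}} u w c → Prime p → ¬ p ∣ c → u < p → w < p →
                    (u * c) % p ≡ (w * c) % p → u ≡ w
*-cancelʳ-%-prime {p} u w c p-prime p∤c u<p w<p uc≡wc =
  ≤-antisym (≤-half u w u<p uc≡wc) (≤-half w u w<p (sym uc≡wc))
  where
  ≤-half : ∀ u w → u < p → (u * c) % p ≡ (w * c) % p → u ≤ w
  ≤-half u w u<p uc≡wc with euclidsLemma (u ∸ w) c p-prime
                              (subst (p ∣_) (sym (*-distribʳ-∸ c u w)) (%≡%⇒∣∸ (u * c) (w * c) p uc≡wc))
  ... | inj₁ p∣u∸w = m∸n≡0⇒m≤n (∣∧<⇒≡0 p∣u∸w (≤-<-trans (m∸n≤m u w) u<p))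
  ... | inj₂ p∣c   = contradiction p∣c p∤c

∣m+[n∸o]⇔%≡% : ∀ {d n} m o .{{_ : NonZero d}} → d ∣ n → o ≤ n → d ∣ m + (n ∸ o) ⇔ m % d ≡ o % d
∣m+[n∸o]⇔%≡% {d} {n} m o d∣n o≤n = mk⇔ ∣⇒%≡% %≡%⇒∣
  where
  open ≡-Reasoning
  m+n≡[m+[n∸o]]+o : m + n ≡ m + (n ∸ o) + o
  m+n≡[m+[n∸o]]+o = trans (cong (m +_) (sym (m∸n+n≡m o≤n))) (sym (+-assoc m (n ∸ o) o))
  ∣⇒%≡% : d ∣ m + (n ∸ o) → m % d ≡ o % d
  ∣⇒%≡% d∣m+[n∸o] = begin
    m % d                   ≡⟨ %-remove-+ʳ m d∣n ⟨
    (m + n) % d             ≡⟨ cong (_% d) m+n≡[m+[n∸o]]+o ⟩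
    (m + (n ∸ o) + o) % d   ≡⟨ %-remove-+ˡ o d∣m+[n∸o] ⟩
    o % d                   ∎
  %≡%⇒∣ : m % d ≡ o % d → d ∣ m + (n ∸ o)
  %≡%⇒∣ m%d≡o%d = m%n≡0⇒n∣m _ d (begin
    (m + (n ∸ o)) % d             ≡⟨ %-distribˡ-+ m (n ∸ o) d ⟩
    (m % d + (n ∸ o) % d) % d     ≡⟨ cong (λ r → (r + (n ∸ o) % d) % d) m%d≡o%d ⟩
    (o % d + (n ∸ o) % d) % d     ≡⟨ %-distribˡ-+ o (n ∸ o) d ⟨
    (o + (n ∸ o)) % d             ≡⟨ cong (_% d) (m+[n∸m]≡n o≤n) ⟩
    n % d                         ≡⟨ n∣m⇒m%n≡0 n d d∣n ⟩
    0                             ∎)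

ResidueSeparated : ℕ → ℕ → ℕ → Set
ResidueSeparated N x y = ∀ {q} .{{_ : NonZero q}} → Prime q → q ∣ N → x % q ≢ y % q

unitaryAdj⇔residueSeparated : ∀ N .{{_ : NonZero N}} (x y : Fin N) →
                              UnitaryAdj N x y ⇔ ResidueSeparated N (toℕ x) (toℕ y)
unitaryAdj⇔residueSeparated N x y = mk⇔ adj⇒separated separated⇒adj
  where
  open Equivalence
  coprime⇔ : UnitaryAdj N x y ⇔ (∀ {q} → Prime q → q ∣ (toℕ x + (N ∸ toℕ y)) % N → ¬ q ∣ N)
  coprime⇔ = coprime⇔noCommonPrimeDivisor ((toℕ x + (N ∸ toℕ y)) % N) N
  ∣x-y⇔ : ∀ {q} .{{_ : NonZero q}} → q ∣ N → q ∣ toℕ x + (N ∸ toℕ y) ⇔ toℕ x % q ≡ toℕ y % q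
  ∣x-y⇔ q∣N = ∣m+[n∸o]⇔%≡% (toℕ x) (toℕ y) q∣N (<⇒≤ (toℕ<n y))
  adj⇒separated : UnitaryAdj N x y → ResidueSeparated N (toℕ x) (toℕ y)
  adj⇒separated adj q-prime q∣N x≡y =
    to coprime⇔ adj q-prime (%-presˡ-∣ (from (∣x-y⇔ q∣N) x≡y) q∣N) q∣N
  separated⇒adj : ResidueSeparated N (toℕ x) (toℕ y) → UnitaryAdj N x y
  separated⇒adj separated = from coprime⇔ λ q-prime q∣x-y q∣N →
    let instance _ = prime⇒nonZero q-prime
    in separated q-prime q∣N (to (∣x-y⇔ q∣N) (∣n∣m%n⇒∣m q∣N q∣x-y))

inducedCycle-transport : ∀ {V W : Set} {_≈_ Adj : V → V → Set} {_≈′_ Adj′ : W → W → Set} {k}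
  {v : Fin k → V} → IsInducedCycle _≈_ Adj k v → (w : Fin k → W) →
  (∀ a b → w a ≈′ w b → a ≡ b) →
  (∀ a b → Adj′ (w a) (w b) ⇔ Adj (v a) (v b)) →
  IsInducedCycle _≈′_ Adj′ k w
inducedCycle-transport (k≥3 , _ , adj⇒cyc , cyc⇒adj) w w-injective adj⇔ =
  k≥3 , w-injective ,
  (λ a b adj → adj⇒cyc a b (Equivalence.to (adj⇔ a b) adj)) ,
  (λ a b cyc → Equivalence.from (adj⇔ a b) (cyc⇒adj a b cyc))

mod-≡⇔%-≡ : ∀ m o n .{{_ : NonZero n}} → m mod n ≡ o mod n ⇔ m % n ≡ o % n
mod-≡⇔%-≡ m o n = mk⇔
  (λ m≡o → trans (sym (toℕ-fromℕ< _)) (trans (cong toℕ m≡o) (toℕ-fromℕ< _)))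
  (λ m≡o → toℕ-injective (trans (toℕ-fromℕ< _) (trans m≡o (sym (toℕ-fromℕ< _)))))

∀¬-cong-⇔ : ∀ {I : Set} {A B : I → Set} → (∀ i → A i ⇔ B i) → (∀ i → ¬ A i) ⇔ (∀ i → ¬ B i)
∀¬-cong-⇔ A⇔B = mk⇔ (λ ¬A i b → ¬A i (Equivalence.from (A⇔B i) b))
                    (λ ¬B i a → ¬B i (Equivalence.to (A⇔B i) a))

EnumeratesPrimeDivisors : ∀ {r} → (Fin r → ℕ) → ℕ → Set
EnumeratesPrimeDivisors p N =
  (∀ i → Prime (p i)) × (∀ i → p i ∣ N) × (∀ {q} → Prime q → q ∣ N → ∃[ i ] q ≡ p i)

primeDivisorCount⇒enumeration : ∀ {N r} → HasPrimeDivisorCount N r →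
                                ∃[ p ] EnumeratesPrimeDivisors {r} p N
primeDivisorCount⇒enumeration (ps , _ , ps-prime , ps∣N , complete , refl) =
  lookup ps , All.lookup ps-prime ∘ ∈-lookup , All.lookup ps∣N ∘ ∈-lookup ,
  λ q-prime q∣N → let q∈ps = complete _ q-prime q∣N in index q∈ps , lookup-index q∈ps

injectiveEnumeration⇒primeDivisorCount : ∀ {N r} {p : Fin r → ℕ} → EnumeratesPrimeDivisors p N →
                                         (∀ {i j} → p i ≡ p j → i ≡ j) → HasPrimeDivisorCount N r
injectiveEnumeration⇒primeDivisorCount {p = p} (p-prime , p∣N , complete) p-injective =
  tabulate p , Unique.tabulate⁺ p-injective , All.tabulate⁺ p-prime , All.tabulate⁺ p∣N ,
  (λ q q-prime q∣N → let i , q≡pᵢ = complete q-prime q∣N in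
                       subst (_∈ tabulate p) (sym q≡pᵢ) (∈-tabulate⁺ i)) ,
  length-tabulate p

module PrimeEnumeration {r} (p : Fin r → ℕ) (p-prime : ∀ i → Prime (p i)) where

  instance
    p-nonZero : ∀ {i} → NonZero (p i)
    p-nonZero = prime⇒nonZero (p-prime _)

  unitaryAdj⇔separatedModulo : ∀ {N} .{{_ : NonZero N}} (x y : Fin N) → EnumeratesPrimeDivisors p N →
                               UnitaryAdj N x y ⇔ (∀ i → toℕ x % p i ≢ toℕ y % p i)
  unitaryAdj⇔separatedModulo {N} x y (_ , p∣N , complete) =
    mk⇔ (λ separated i → separated (p-prime i) (p∣N i)) separatedAll⇒separated
      ⇔-∘ unitaryAdj⇔residueSeparated N x y
    where
    separatedAll⇒separated : (∀ i → toℕ x % p i ≢ toℕ y % p i) → ResidueSeparated N (toℕ x) (toℕ y)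
    separatedAll⇒separated h q-prime q∣N with complete q-prime q∣N
    ... | i , refl = h i

  residueGraph : ∀ N .{{_ : NonZero N}} → (∀ i → p i ∣ N) → ConjMultipartite r
  residueGraph N p∣N = record
    { parts     = p
    ; parts-pos = λ i → <⇒≤ (prime⇒>1 (p-prime i))
    ; size      = λ _ → N
    ; label     = λ i x → toℕ x mod p i
    ; label-sur = λ i c → let c<N = <-≤-trans (toℕ<n c) (∣⇒≤ (p∣N i)) in
        fromℕ< c<N ,
        toℕ-injective (trans (toℕ-fromℕ< _) (trans (cong (_% p i) (toℕ-fromℕ< c<N)) (m<n⇒m%n≡m (toℕ<n c))))
    }

  inducedCycle⇒conjunction : ∀ {N k} .{{_ : NonZero N}} → Fin r → EnumeratesPrimeDivisors p N →
                             XHasInducedCycle N k → μSet r k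
  inducedCycle⇒conjunction {N} i₀ enum@(_ , p∣N , _) (v , cycle) =
    G , w , inducedCycle-transport {_≈_ = _≡_} {UnitaryAdj N} {_≈V_} {Adj} cycle w
      (λ a b wa≈wb → proj₁ (proj₂ cycle) a b (wa≈wb i₀)) adj⇔
    where
    G = residueGraph N p∣N
    open ConjMultipartite G using (Vertex; _≈V_; Adj)
    w : Fin _ → Vertex
    w a _ = v a
    adj⇔ : ∀ a b → Adj (w a) (w b) ⇔ UnitaryAdj N (v a) (v b)
    adj⇔ a b = ⇔-sym (unitaryAdj⇔separatedModulo (v a) (v b) enum)
           ⇔-∘ ∀¬-cong-⇔ (λ i → mod-≡⇔%-≡ (toℕ (v a)) (toℕ (v b)) (p i))

∣-sum : ∀ {d n} (f : Fin n → ℕ) → (∀ i → d ∣ f i) → d ∣ sum f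
∣-sum {n = zero}  f d∣f = _ ∣0
∣-sum {n = suc n} f d∣f = ∣m∣n⇒∣m+n (d∣f Fin.zero) (∣-sum (f ∘ Fin.suc) (d∣f ∘ Fin.suc))

≤-sum : ∀ {n} (f : Fin n → ℕ) i → f i ≤ sum f
≤-sum {suc n} f i = subst (f i ≤_) (sym (sum-remove f)) (m≤m+n (f i) _)

mSet-intro : ∀ {r k} N .{{_ : NonZero N}} → HasPrimeDivisorCount N r → XHasInducedCycle N k → mSet r k
mSet-intro (suc N) count cycle = N , count , cycle

prime∣∏primes⇒≡ : ∀ {n q} (f : Fin n → ℕ) → (∀ i → Prime (f i)) → Prime q →
                  q ∣ product (tabulate f) → ∃[ i ] q ≡ f i
prime∣∏primes⇒≡ f f-prime q-prime q∣∏f =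
  ∈-tabulate⁻ (factorisationHasAllPrimeFactors q-prime q∣∏f (All.tabulate⁺ f-prime))

module CRT {r} (p : Fin (suc r) → ℕ) (p-prime : ∀ i → Prime (p i))
           (p-injective : ∀ {i j} → p i ≡ p j → i ≡ j) where

  open PrimeEnumeration p p-prime using (p-nonZero; unitaryAdj⇔separatedModulo)

  P : ℕ
  P = product (tabulate p)

  Q : Fin (suc r) → ℕ
  Q i = product (tabulate (removeAt p i))

  instance
    P-nonZero : NonZero P
    P-nonZero = productOfPrimes≢0 (All.tabulate⁺ p-prime)

  p∣P : ∀ i → p i ∣ P
  p∣P i = ∈⇒∣product (∈-tabulate⁺ {f = p} i)

  prime∣P⇒≡p : ∀ {q} → Prime q → q ∣ P → ∃[ i ] q ≡ p i
  prime∣P⇒≡p q-prime q∣P = prime∣∏primes⇒≡ p p-prime q-prime q∣P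

  p∤Q : ∀ i → ¬ p i ∣ Q i
  p∤Q i pᵢ∣Qᵢ with prime∣∏primes⇒≡ (removeAt p i) (p-prime ∘ punchIn i) (p-prime i) pᵢ∣Qᵢ
  ... | k , pᵢ≡pₖ = punchInᵢ≢i i k (sym (p-injective pᵢ≡pₖ))

  p∣Q : ∀ {i l} → i ≢ l → p l ∣ Q i
  p∣Q {i} i≢l = subst (λ m → p m ∣ Q i) (punchIn-punchOut i≢l)
                       (∈⇒∣product (∈-tabulate⁺ {f = removeAt p i} (punchOut i≢l)))

  encode : (Fin (suc r) → ℕ) → ℕ
  encode c = sum (λ l → c l * Q l) % P

  encode<P : ∀ c → encode c < P
  encode<P c = m%n<n _ P

  encode-% : ∀ c i → encode c % p i ≡ (c i * Q i) % p i
  encode-% c i = begin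
    sum t % P % p i                          ≡⟨ m∣n⇒o%n%m≡o%m (p i) P (sum t) (p∣P i) ⟩
    sum t % p i                              ≡⟨ cong (_% p i) (sum-remove t) ⟩
    (t i + sum (removeAt t i)) % p i         ≡⟨ %-remove-+ʳ (t i) pᵢ∣rest ⟩
    t i % p i                                ∎
    where
    open ≡-Reasoning
    t : Fin (suc r) → ℕ
    t l = c l * Q l
    pᵢ∣rest : p i ∣ sum (removeAt t i)
    pᵢ∣rest = ∣-sum (removeAt t i) λ k → ∣n⇒∣m*n (c (punchIn i k)) (p∣Q (punchInᵢ≢i i k))

  conjunctionCycle⇒mSet : (G : ConjMultipartite (suc r)) → (∀ i → ConjMultipartite.parts G i ≤ p i) →
    ∀ {k} (v : Fin k → ConjMultipartite.Vertex G) →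
    IsInducedCycle (ConjMultipartite._≈V_ G) (ConjMultipartite.Adj G) k v → mSet (suc r) k
  conjunctionCycle⇒mSet G parts≤p {k} v cycle =
    mSet-intro n (injectiveEnumeration⇒primeDivisorCount enumeration p-injective) (y , cycle′)
    where
    open ConjMultipartite G

    L : Fin k → Fin (suc r) → ℕ
    L a i = toℕ (label i (v a i))

    L<p : ∀ a i → L a i < p i
    L<p a i = <-≤-trans (toℕ<n _) (parts≤p i)

    x : Fin k → ℕ
    x a = encode (L a) + toℕ a * P

    n : ℕ
    n = P ^ suc k

    instance
      n-nonZero : NonZero n
      n-nonZero = m^n≢0 P (suc k)

    x<n : ∀ a → x a < n
    x<n a = begin-strict
      encode (L a) + toℕ a * P  <⟨ +-monoˡ-< (toℕ a * P) (encode<P (L a)) ⟩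
      suc (toℕ a) * P           ≤⟨ *-monoˡ-≤ P (toℕ<n a) ⟩
      k * P                     ≤⟨ *-monoˡ-≤ P (<⇒≤ (n<m^n 1<P k)) ⟩
      P ^ k * P                 ≡⟨ *-comm (P ^ k) P ⟩
      n                         ∎
      where
      open ≤-Reasoning
      1<P : 1 < P
      1<P = <-≤-trans (prime⇒>1 (p-prime Fin.zero)) (∣⇒≤ (p∣P Fin.zero))

    y : Fin k → Fin n
    y a = fromℕ< (x<n a)

    x/P≡a : ∀ a → x a / P ≡ toℕ a
    x/P≡a a = begin
      (encode (L a) + toℕ a * P) / P       ≡⟨ +-distrib-/-∣ʳ (encode (L a)) (n∣m*n (toℕ a)) ⟩
      encode (L a) / P + toℕ a * P / P     ≡⟨ cong₂ _+_ (m<n⇒m/n≡0 (encode<P (L a))) (m*n/n≡m (toℕ a) P) ⟩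
      toℕ a                                ∎
      where open ≡-Reasoning

    y-injective : ∀ a b → y a ≡ y b → a ≡ b
    y-injective a b ya≡yb = toℕ-injective (begin
      toℕ a          ≡⟨ x/P≡a a ⟨
      x a / P        ≡⟨ cong (_/ P) (trans (sym (toℕ-fromℕ< _)) (trans (cong toℕ ya≡yb) (toℕ-fromℕ< _))) ⟩
      x b / P        ≡⟨ x/P≡a b ⟩
      toℕ b          ∎)
      where open ≡-Reasoning

    y-% : ∀ a i → toℕ (y a) % p i ≡ (L a i * Q i) % p i
    y-% a i = begin
      toℕ (y a) % p i                      ≡⟨ cong (_% p i) (toℕ-fromℕ< (x<n a)) ⟩
      (encode (L a) + toℕ a * P) % p i     ≡⟨ %-remove-+ʳ (encode (L a)) (∣n⇒∣m*n (toℕ a) (p∣P i)) ⟩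
      encode (L a) % p i                   ≡⟨ encode-% (L a) i ⟩
      (L a i * Q i) % p i                  ∎
      where open ≡-Reasoning

    label≡⇔y≡ : ∀ a b i → label i (v a i) ≡ label i (v b i) ⇔ toℕ (y a) % p i ≡ toℕ (y b) % p i
    label≡⇔y≡ a b i = mk⇔
      (λ labels≡ → trans (y-% a i) (trans (cong (λ l → (toℕ l * Q i) % p i) labels≡) (sym (y-% b i))))
      (λ y≡ → toℕ-injective (*-cancelʳ-%-prime (L a i) (L b i) (Q i) (p-prime i) (p∤Q i) (L<p a i) (L<p b i)
        (trans (sym (y-% a i)) (trans y≡ (y-% b i)))))

    enumeration : EnumeratesPrimeDivisors p n
    enumeration = p-prime , (λ i → ∣-trans (p∣P i) (m∣m*n (P ^ k))) ,
      λ q-prime q∣n → prime∣P⇒≡p q-prime (prime∣m^n⇒∣m P (suc k) q-prime q∣n)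

    cycle′ : IsInducedCycle _≡_ (UnitaryAdj n) k y
    cycle′ = inducedCycle-transport {_≈_ = _≈V_} {Adj} {_≡_} {UnitaryAdj n} cycle y y-injective λ a b →
      ⇔-sym (∀¬-cong-⇔ (label≡⇔y≡ a b)) ⇔-∘ unitaryAdj⇔separatedModulo (y a) (y b) enumeration

mSet⇒μSet : ∀ {r k} → mSet (suc r) k → μSet (suc r) k
mSet⇒μSet (N , count , cycle) with primeDivisorCount⇒enumeration count
... | p , enumeration@(p-prime , _) =
  PrimeEnumeration.inducedCycle⇒conjunction p p-prime Fin.zero enumeration cycle

μSet⇒mSet : ∀ {r k} → μSet (suc r) k → mSet (suc r) k
μSet⇒mSet {r} (G , v , cycle) = CRT.conjunctionCycle⇒mSet p p-prime p-injective G parts≤p v cycle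
  where
  K : ℕ
  K = sum (ConjMultipartite.parts G)
  p : Fin (suc r) → ℕ
  p i = primeAbove K (toℕ i)
  p-prime : ∀ i → Prime (p i)
  p-prime i = primeAbove-prime K (toℕ i)
  p-injective : ∀ {i j} → p i ≡ p j → i ≡ j
  p-injective = toℕ-injective ∘ primeAbove-injective K
  parts≤p : ∀ i → ConjMultipartite.parts G i ≤ p i
  parts≤p i = ≤-trans (≤-sum (ConjMultipartite.parts G) i) (<⇒≤ (<primeAbove K (toℕ i)))

isMax-transfer : ∀ {P Q : ℕ → Set} {k} → (∀ {j} → P j → Q j) → (∀ {j} → Q j → P j) → IsMax P k → IsMax Q k
isMax-transfer P⇒Q Q⇒P (Pk , max) = P⇒Q Pk , λ j Qj → max j (Q⇒P Qj)

-- The equality already holds for every r ≥ 1; the hypothesis is only used to exclude r = 0.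
theorem4p2 : (r : ℕ) → 1 < r → (k : ℕ) →
    (Isμ r k → IsM r k) × (IsM r k → Isμ r k)
theorem4p2 (suc r) _ k = isMax-transfer μSet⇒mSet mSet⇒μSet , isMax-transfer mSet⇒μSet μSet⇒mSet
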